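{- Let $D$ be a digraph without digons of order $n$, and let $k,l$ be integers with $2\leq k\leq \min\{l,n-1\}$. Let $\alpha$ and $\beta$ be two $l$-colorings of $D$ such that the color class $C_1^\beta$ of $\beta$ has exactly two vertices, the color classes $C_2^\beta,C_3^\beta,\dots,C_k^\beta$ are singletons, and $\alpha(u)=\beta(u)$ for each $u\in V(D)\setminus\bigcup_{i=1}^k C_i^\beta$. Then $d(\alpha,\beta)\leq k+1$ in $\mathcal{D}_l(D)$.
   Context: All digraphs are finite, loopless and without digons. For a digraph $D$ and a positive integer $l$, an $l$-coloring of $D$ is a function $\alpha\colon V(D)\to\{1,\dots,l\}$ such that every color class $C_i^\alpha=\{x\in V(D):\alpha(x)=i\}$ (possibly empty) induces an acyclic subdigraph. The $l$-dicoloring graph $\mathcal{D}_l(D)$ has the $l$-colorings of $D$ as vertices, two being adjacent iff they differ on exactly one vertex; $d(\alpha,\beta)$ denotes the distance in this graph. -}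

module Defs where

open import Data.Nat using (ℕ; zero; suc; _≤_; _<_)
open import Data.Fin using (Fin; zero; suc; inject₁; fromℕ; toℕ)
open import Data.Bool using (Bool; T)
open import Data.Product using (Σ; ∃; _×_; _,_)
open import Data.Sum using (_⊎_)
open import Data.Empty using (⊥)
open import Relation.Nullary using (¬_)
open import Relation.Binary.PropositionalEquality using (_≡_; _≢_)

record Digraph (n : ℕ) : Set where
  field
    adj      : Fin n → Fin n → Bool
    loopless : ∀ x → ¬ T (adj x x)
    noDigon  : ∀ x y → T (adj x y) → ¬ T (adj y x)
open Digraph public

Arc : ∀ {n} → Digraph n → Fin n → Fin n → Set
Arc D x y = T (adj D x y)

record CycleIn {n : ℕ} (D : Digraph n) (S : Fin n → Set) (m : ℕ) : Set where
  field
    vtx      : Fin (suc m) → Fin n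
    distinct : ∀ i j → vtx i ≡ vtx j → i ≡ j
    inside   : ∀ i → S (vtx i)
    step     : ∀ (i : Fin m) → Arc D (vtx (inject₁ i)) (vtx (suc i))
    close    : Arc D (vtx (fromℕ m)) (vtx zero)

Acyclic : ∀ {n} → Digraph n → (Fin n → Set) → Set
Acyclic D S = ∀ m → ¬ CycleIn D S m

-- Color classes are indexed by Fin l; color i (1 ≤ i ≤ l) of the paper
-- is the element of Fin l with toℕ equal to i - 1.
ColorClass : ∀ {n l} → (Fin n → Fin l) → Fin l → Fin n → Set
ColorClass α i x = α x ≡ i

record Coloring {n : ℕ} (D : Digraph n) (l : ℕ) : Set where
  field
    col     : Fin n → Fin l
    acyclic : ∀ (i : Fin l) → Acyclic D (ColorClass col i)
open Coloring public

Adjacent : ∀ {n l} {D : Digraph n} → Coloring D l → Coloring D l → Set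
Adjacent {n} α β =
  Σ (Fin n) λ v → (col α v ≢ col β v) × (∀ u → u ≢ v → col α u ≡ col β u)

data Walk {n l : ℕ} {D : Digraph n} : Coloring D l → Coloring D l → ℕ → Set where
  here : ∀ {α β} → (∀ x → col α x ≡ col β x) → Walk α β zero
  next : ∀ {α γ β m} → Adjacent α γ → Walk γ β m → Walk α β (suc m)

DistLe : ∀ {n l} {D : Digraph n} → Coloring D l → Coloring D l → ℕ → Set
DistLe α β t = Σ ℕ λ m → (m ≤ t) × Walk α β m

-- Starting from α, repeatedly recolour a vertex v on which the current colouring γ differs
-- from β to its target colour β v, choosing v so that the class of β v under γ has at most one
-- vertex; the new class then has at most two vertices and is acyclic, as D has no loops or
-- digons. Such a v exists while γ ≠ β: otherwise every class c < k of γ is at least as large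
-- as that of β, but γ uses colours c < k only on the k + 1 vertices of C_1^β ∪ … ∪ C_k^β, and
-- comparing the two sums ∑_{c<k} |C_c| leaves no room for a vertex with the wrong colour.
-- Each step fixes one vertex and only those k + 1 vertices ever need fixing.
module Submission where

open import Defs
open import Data.Empty using (⊥)
open import Data.Fin using (Fin; zero; suc; toℕ; inject₁; fromℕ; fromℕ<; punchIn)
import Data.Fin.Properties as Fin
open import Data.Fin.Patterns using (0F; 1F; 2F)
open import Data.Nat using (ℕ; zero; suc; _+_; _≤_; _<_; z≤n; s≤s; _≟_; _<?_)
open import Data.Nat.Induction using (<-wellFounded)
open import Data.Nat.Properties
open import Algebra.Properties.CommutativeMonoid.Sum +-0-commutativeMonoid using (sum-remove)
open import Algebra.Properties.CommutativeSemigroup +-commutativeSemigroup using (interchange)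
open import Algebra.Properties.Monoid.Sum +-0-monoid
  using (sum; sum-syntax; sum-cong-≗; sum-init-last; sum-replicate-zero)
open import Data.Product using (Σ; _×_; _,_; proj₁; proj₂)
open import Data.Sum using (_⊎_; inj₁; inj₂; [_,_]′)
import Data.Sum as Sum
open import Data.Vec.Functional using (updateAt)
open import Data.Vec.Functional.Properties using (updateAt-updates; updateAt-minimal)
open import Function using (_∘_; const; id)
open import Induction.WellFounded using (Acc; acc)
open import Level using (Level; 0ℓ)
open import Relation.Nullary using (¬_; Dec; yes; no; ¬?; contradiction)
open import Relation.Nullary.Decidable using (_⊎-dec_; _×-dec_; decidable-stable)
open import Relation.Unary using (Pred; Decidable; _⊆_)
open import Relation.Unary.Properties using (∅?)
open import Relation.Binary.PropositionalEquality
  using (_≡_; _≢_; refl; sym; trans; cong; cong₂; subst; subst₂; module ≡-Reasoning)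

private variable
  n : ℕ
  ℓ₁ ℓ₂ : Level
  A : Set ℓ₁
  B : Set ℓ₂
  P : Pred (Fin n) ℓ₁
  Q : Pred (Fin n) ℓ₂

𝟙 : Dec A → ℕ
𝟙 (yes _) = 1
𝟙 (no _)  = 0

𝟙≤1 : (A? : Dec A) → 𝟙 A? ≤ 1
𝟙≤1 (yes _) = ≤-refl
𝟙≤1 (no _)  = z≤n

𝟙-no : (A? : Dec A) → ¬ A → 𝟙 A? ≡ 0
𝟙-no (yes x) ¬x = contradiction x ¬x
𝟙-no (no _)  _  = refl

𝟙-mono : (A? : Dec A) (B? : Dec B) → (A → B) → 𝟙 A? ≤ 𝟙 B?
𝟙-mono (yes _) (yes _) _   = ≤-refl
𝟙-mono (yes x) (no ¬y) A⇒B = contradiction (A⇒B x) ¬y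
𝟙-mono (no _)  _       _   = z≤n

𝟙-mono-< : (A? : Dec A) (B? : Dec B) → ¬ A → B → 𝟙 A? < 𝟙 B?
𝟙-mono-< (yes x) _       ¬x _ = contradiction x ¬x
𝟙-mono-< (no _)  (yes _) _  _ = s≤s z≤n
𝟙-mono-< (no _)  (no ¬y) _  y = contradiction y ¬y

𝟙-⊎ : (A? : Dec A) (B? : Dec B) → 𝟙 (A? ⊎-dec B?) ≤ 𝟙 A? + 𝟙 B?
𝟙-⊎ (yes _) _       = s≤s z≤n
𝟙-⊎ (no _)  (yes _) = ≤-refl
𝟙-⊎ (no _)  (no _)  = z≤n

sum-mono-≤ : ∀ {f g : Fin n → ℕ} → (∀ i → f i ≤ g i) → sum f ≤ sum g
sum-mono-≤ {zero}  f≤g = z≤n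
sum-mono-≤ {suc n} f≤g = +-mono-≤ (f≤g zero) (sum-mono-≤ (f≤g ∘ suc))

sum-mono-< : ∀ {f g : Fin n → ℕ} → (∀ i → f i ≤ g i) → ∀ i → f i < g i → sum f < sum g
sum-mono-< {suc n} f≤g zero    fi<gi = +-mono-<-≤ fi<gi (sum-mono-≤ (f≤g ∘ suc))
sum-mono-< {suc n} f≤g (suc i) fi<gi = +-mono-≤-< (f≤g zero) (sum-mono-< (f≤g ∘ suc) i fi<gi)

sum-distrib-+ : ∀ (f g : Fin n → ℕ) → ∑[ i < n ] (f i + g i) ≡ sum f + sum g
sum-distrib-+ {zero}  f g = refl
sum-distrib-+ {suc n} f g = trans (cong (f zero + g zero +_) (sum-distrib-+ (f ∘ suc) (g ∘ suc)))
                                  (interchange (f zero) (g zero) (sum (f ∘ suc)) (sum (g ∘ suc)))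

∑1≡n : ∀ n → ∑[ i < n ] 1 ≡ n
∑1≡n zero    = refl
∑1≡n (suc n) = cong suc (∑1≡n n)

count : Decidable P → ℕ
count {n} P? = ∑[ z < n ] 𝟙 (P? z)

count-mono : (P? : Decidable P) (Q? : Decidable Q) → P ⊆ Q → count P? ≤ count Q?
count-mono P? Q? P⊆Q = sum-mono-≤ (λ z → 𝟙-mono (P? z) (Q? z) P⊆Q)

count-mono-< : (P? : Decidable P) (Q? : Decidable Q) → P ⊆ Q →
               ∀ {a} → ¬ P a → Q a → count P? < count Q?
count-mono-< P? Q? P⊆Q {a} ¬Pa Qa =
  sum-mono-< (λ z → 𝟙-mono (P? z) (Q? z) P⊆Q) a (𝟙-mono-< (P? a) (Q? a) ¬Pa Qa)

count-∪ : (P? : Decidable P) (Q? : Decidable Q) →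
          count (λ z → P? z ⊎-dec Q? z) ≤ count P? + count Q?
count-∪ P? Q? = ≤-trans (sum-mono-≤ (λ z → 𝟙-⊎ (P? z) (Q? z)))
                        (≤-reflexive (sum-distrib-+ (𝟙 ∘ P?) (𝟙 ∘ Q?)))

count-∅ : (P? : Decidable P) → (∀ z → ¬ P z) → count P? ≡ 0
count-∅ {n} P? ¬P = trans (sum-cong-≗ (λ z → 𝟙-no (P? z) (¬P z))) (sum-replicate-zero n)

count≤1 : (P? : Decidable P) → ∀ {a} → P ⊆ (_≡ a) → count P? ≤ 1
count≤1 {suc n} P? {a} P⊆a = begin
  count P?
    ≡⟨ sum-remove {i = a} (𝟙 ∘ P?) ⟩
  𝟙 (P? a) + ∑[ i < n ] 𝟙 (P? (punchIn a i))
    ≡⟨ cong (𝟙 (P? a) +_) (count-∅ (P? ∘ punchIn a) (λ i → Fin.punchInᵢ≢i a i ∘ P⊆a)) ⟩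
  𝟙 (P? a) + 0
    ≡⟨ +-identityʳ _ ⟩
  𝟙 (P? a)
    ≤⟨ 𝟙≤1 (P? a) ⟩
  1 ∎
  where open ≤-Reasoning

1≤count : (P? : Decidable P) → ∀ {a} → P a → 1 ≤ count P?
1≤count P? Pa = ≤-trans (s≤s z≤n) (count-mono-< ∅? P? (λ ()) (λ ()) Pa)

2≤count : (P? : Decidable P) → ∀ {a b} → a ≢ b → P a → P b → 2 ≤ count P?
2≤count P? {a} a≢b Pa Pb =
  ≤-trans (s≤s (1≤count (Fin._≟ a) refl))
          (count-mono-< (Fin._≟ a) P? (λ { refl → Pa }) (a≢b ∘ sym) Pb)

count≤1⇒⊆singleton : (P? : Decidable P) → count P? ≤ 1 → Fin n →
                     Σ (Fin n) λ a → P ⊆ (_≡ a)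
count≤1⇒⊆singleton P? count≤1 default with Fin.any? P?
... | yes (a , Pa) =
  a , λ {z} Pz → decidable-stable (z Fin.≟ a) (λ z≢a → <⇒≱ (2≤count P? z≢a Pz Pa) count≤1)
... | no  ∄P = default , λ {z} Pz → contradiction (z , Pz) ∄P

count≤2 : (P? : Decidable P) → ∀ {a b} → P ⊆ (λ z → z ≡ a ⊎ z ≡ b) → count P? ≤ 2
count≤2 P? {a} {b} P⊆ab = begin
  count P?                                ≤⟨ count-mono P? (λ z → z Fin.≟ a ⊎-dec z Fin.≟ b) P⊆ab ⟩
  count (λ z → z Fin.≟ a ⊎-dec z Fin.≟ b) ≤⟨ count-∪ (Fin._≟ a) (Fin._≟ b) ⟩
  count (Fin._≟ a) + count (Fin._≟ b)     ≤⟨ +-mono-≤ (count≤1 (Fin._≟ a) id)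
                                                        (count≤1 (Fin._≟ b) id) ⟩
  2                                       ∎
  where open ≤-Reasoning

𝟙-<-suc : ∀ m j → 𝟙 (m <? suc j) ≡ 𝟙 (m <? j) + 𝟙 (m ≟ j)
𝟙-<-suc m j with m <? j | m ≟ j | m <? suc j
... | yes m<j | yes refl | _         = contradiction m<j (<-irrefl refl)
... | yes _   | no _     | yes _     = refl
... | yes m<j | no _     | no m≮1+j  = contradiction (m<n⇒m<1+n m<j) m≮1+j
... | no _    | yes _    | yes _     = refl
... | no _    | yes refl | no m≮1+j  = contradiction (n<1+n m) m≮1+j
... | no m≮j  | no m≢j   | yes m<1+j = contradiction (≤∧≢⇒< (≤-pred m<1+j) m≢j) m≮j
... | no _    | no _     | no _      = refl

count-<-fibres : ∀ (f : Fin n → ℕ) j →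
                 count (λ z → f z <? j) ≡ ∑[ c < j ] count (λ z → f z ≟ toℕ c)
count-<-fibres f zero    = count-∅ (λ z → f z <? 0) (λ z ())
count-<-fibres {n} f (suc j) = begin
  count (λ z → f z <? suc j)
    ≡⟨ sum-cong-≗ (λ z → 𝟙-<-suc (f z) j) ⟩
  ∑[ z < n ] (𝟙 (f z <? j) + 𝟙 (f z ≟ j))
    ≡⟨ sum-distrib-+ (λ z → 𝟙 (f z <? j)) (λ z → 𝟙 (f z ≟ j)) ⟩
  count (λ z → f z <? j) + fibre j
    ≡⟨ cong₂ _+_ (count-<-fibres f j) (cong fibre (sym (Fin.toℕ-fromℕ j))) ⟩
  ∑[ c < j ] fibre (toℕ c) + fibre (toℕ (fromℕ j))
    ≡⟨ cong (_+ fibre (toℕ (fromℕ j))) (sum-cong-≗ {j} (λ c → cong fibre (sym (Fin.toℕ-inject₁ c)))) ⟩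
  ∑[ c < j ] fibre (toℕ (inject₁ c)) + fibre (toℕ (fromℕ j))
    ≡⟨ sum-init-last (fibre ∘ toℕ) ⟨
  ∑[ c < suc j ] fibre (toℕ c) ∎
  where
  open ≡-Reasoning
  fibre : ℕ → ℕ
  fibre c = count (λ z → f z ≟ c)

acyclic-⊆ : (D : Digraph n) {S T : Pred (Fin n) 0ℓ} → S ⊆ T → Acyclic D T → Acyclic D S
acyclic-⊆ D S⊆T acyclic-T m cycle =
  acyclic-T m record { CycleIn cycle hiding (inside) ; inside = S⊆T ∘ CycleIn.inside cycle }

pair-pigeonhole : ∀ {a b u v w : A} → u ≡ a ⊎ u ≡ b → v ≡ a ⊎ v ≡ b → w ≡ a ⊎ w ≡ b →
                  u ≡ v ⊎ u ≡ w ⊎ v ≡ w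
pair-pigeonhole (inj₁ u≡a) (inj₁ v≡a) _          = inj₁ (trans u≡a (sym v≡a))
pair-pigeonhole (inj₂ u≡b) (inj₂ v≡b) _          = inj₁ (trans u≡b (sym v≡b))
pair-pigeonhole (inj₁ u≡a) (inj₂ _)   (inj₁ w≡a) = inj₂ (inj₁ (trans u≡a (sym w≡a)))
pair-pigeonhole (inj₂ u≡b) (inj₁ _)   (inj₂ w≡b) = inj₂ (inj₁ (trans u≡b (sym w≡b)))
pair-pigeonhole (inj₁ _)   (inj₂ v≡b) (inj₂ w≡b) = inj₂ (inj₂ (trans v≡b (sym w≡b)))
pair-pigeonhole (inj₂ _)   (inj₁ v≡a) (inj₁ w≡a) = inj₂ (inj₂ (trans v≡a (sym w≡a)))

acyclic-⊆-pair : (D : Digraph n) {S : Pred (Fin n) 0ℓ} {a b : Fin n} →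
                 S ⊆ (λ z → z ≡ a ⊎ z ≡ b) → Acyclic D S
acyclic-⊆-pair D S⊆ab zero          cycle = loopless D _ (CycleIn.close cycle)
acyclic-⊆-pair D S⊆ab (suc zero)    cycle =
  noDigon D _ _ (CycleIn.step cycle zero) (CycleIn.close cycle)
acyclic-⊆-pair D S⊆ab (suc (suc m)) record { distinct = distinct ; inside = inside }
  with pair-pigeonhole (S⊆ab (inside 0F)) (S⊆ab (inside 1F)) (S⊆ab (inside 2F))
... | inj₁ v₀≡v₁        = Fin.0≢1+n (distinct 0F 1F v₀≡v₁)
... | inj₂ (inj₁ v₀≡v₂) = Fin.0≢1+n (distinct 0F 2F v₀≡v₂)
... | inj₂ (inj₂ v₁≡v₂) = Fin.0≢1+n (Fin.suc-injective (distinct 1F 2F v₁≡v₂))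

updateAt-const-≡ : ∀ (f : Fin n → A) v c {i} z → updateAt f v (const c) z ≡ i →
                   (z ≡ v × c ≡ i) ⊎ f z ≡ i
updateAt-const-≡ f v c z fz≡i with z Fin.≟ v
... | yes refl = inj₁ (refl , trans (sym (updateAt-updates v f)) fz≡i)
... | no  z≢v  = inj₂ (trans (sym (updateAt-minimal z v f z≢v)) fz≡i)

module _ {l : ℕ} {D : Digraph n} where

  classSize : Coloring D l → ℕ → ℕ
  classSize γ c = count (λ z → toℕ (col γ z) ≟ c)

  recolour : (γ : Coloring D l) (v : Fin n) (c : Fin l) → classSize γ (toℕ c) ≤ 1 → Coloring D l
  col (recolour γ v c _) = updateAt (col γ) v (const c)
  acyclic (recolour γ v c small) i with c Fin.≟ i
  ... | no c≢i = acyclic-⊆ D new⊆old (acyclic γ i)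
    where
    new⊆old : ∀ {z} → updateAt (col γ) v (const c) z ≡ i → col γ z ≡ i
    new⊆old {z} z∈i =
      [ (λ (_ , c≡i) → contradiction c≡i c≢i) , id ]′ (updateAt-const-≡ (col γ) v c z z∈i)
  ... | yes refl with count≤1⇒⊆singleton _ small v
  ...   | a , old⊆a = acyclic-⊆-pair D {a = v} {b = a} λ {z} z∈c →
    Sum.map proj₁ (old⊆a ∘ cong toℕ) (updateAt-const-≡ (col γ) v c z z∈c)

  recolour-adjacent : ∀ γ v c small → col γ v ≢ c → Adjacent γ (recolour γ v c small)
  recolour-adjacent γ v c _ γv≢c =
    v , (λ γv≡c′ → γv≢c (trans γv≡c′ (updateAt-updates v (col γ))))
      , (λ u u≢v → sym (updateAt-minimal u v (col γ) u≢v))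

DistLe-mono : ∀ {l} {D : Digraph n} {α β : Coloring D l} {s t} →
              s ≤ t → DistLe α β s → DistLe α β t
DistLe-mono s≤t (m , m≤s , walk) = m , ≤-trans m≤s s≤t , walk

module Descent {l : ℕ} {D : Digraph n} (β : Coloring D l) where

  Mismatch : Coloring D l → Pred (Fin n) 0ℓ
  Mismatch γ z = col γ z ≢ col β z

  mismatch? : (γ : Coloring D l) → Decidable (Mismatch γ)
  mismatch? γ z = ¬? (col γ z Fin.≟ col β z)

  mismatches : Coloring D l → ℕ
  mismatches γ = count (mismatch? γ)

  module _ (γ : Coloring D l) (v : Fin n) (small : classSize γ (toℕ (col β v)) ≤ 1) where

    fix : Coloring D l
    fix = recolour γ v (col β v) small

    fix-agrees : ∀ {z} → col γ z ≡ col β z → col fix z ≡ col β z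
    fix-agrees {z} γz≡βz with z Fin.≟ v
    ... | yes refl = updateAt-updates v (col γ)
    ... | no  z≢v  = trans (updateAt-minimal z v (col γ) z≢v) γz≡βz

    fix-mismatches-< : Mismatch γ v → mismatches fix < mismatches γ
    fix-mismatches-< γv≢βv =
      count-mono-< (mismatch? fix) (mismatch? γ) (λ fixz≢βz γz≡βz → fixz≢βz (fix-agrees γz≡βz))
                   (λ fixv≢βv → fixv≢βv (updateAt-updates v (col γ))) γv≢βv

  DistLe-by-descent : (Inv : Pred (Coloring D l) 0ℓ) →
    (∀ γ → Inv γ → ∀ {w} → Mismatch γ w →
       Σ (Coloring D l) λ γ′ → Inv γ′ × Adjacent γ γ′ × mismatches γ′ < mismatches γ) →
    ∀ γ → Inv γ → DistLe γ β (mismatches γ)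
  DistLe-by-descent Inv step γ inv = go γ (<-wellFounded (mismatches γ)) inv
    where
    go : ∀ γ → Acc _<_ (mismatches γ) → Inv γ → DistLe γ β (mismatches γ)
    go γ (acc smaller) inv with Fin.all? (λ z → col γ z Fin.≟ col β z)
    ... | yes γ≗β = 0 , z≤n , here γ≗β
    ... | no  γ≉β with Fin.¬∀⟶∃¬ _ _ (λ z → col γ z Fin.≟ col β z) γ≉β
    ...   | w , γw≢βw with step γ inv γw≢βw
    ...     | γ′ , inv′ , γ~γ′ , fewer with go γ′ (smaller fewer) inv′
    ...       | m , m≤ , walk = suc m , ≤-trans (s≤s m≤) fewer , next γ~γ′ walk

module PairAndSingletons {l : ℕ} {D : Digraph n} (β : Coloring D l) (k : ℕ) (k≤l : k ≤ l)
  {x y : Fin n} (pair : ∀ z → toℕ (col β z) ≡ 0 → z ≡ x ⊎ z ≡ y)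
  (singleton : ∀ (i : Fin l) → 1 ≤ toℕ i → toℕ i < k →
               Σ (Fin n) λ v → (col β v ≡ i) × (∀ z → col β z ≡ i → z ≡ v))
  where

  open Descent β

  βₙ : Fin n → ℕ
  βₙ z = toℕ (col β z)

  AgreesBeyond : Pred (Coloring D l) 0ℓ
  AgreesBeyond γ = ∀ u → k ≤ βₙ u → col γ u ≡ col β u

  agrees⊎below : ∀ γ → AgreesBeyond γ → ∀ z → col γ z ≡ col β z ⊎ βₙ z < k
  agrees⊎below γ agrees z with βₙ z <? k
  ... | yes βz<k = inj₂ βz<k
  ... | no  βz≮k = inj₁ (agrees z (≮⇒≥ βz≮k))

  below? : (γ : Coloring D l) → Decidable (λ z → toℕ (col γ z) < k)
  below? γ z = toℕ (col γ z) <? k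

  #below : Coloring D l → ℕ
  #below γ = count (below? γ)

  #below-fibres : ∀ γ → #below γ ≡ ∑[ c < k ] classSize γ (toℕ c)
  #below-fibres γ = count-<-fibres (toℕ ∘ col γ) k

  singletonₙ : ∀ {c} → 1 ≤ c → c < k → Σ (Fin n) λ v → βₙ v ≡ c × (∀ z → βₙ z ≡ c → z ≡ v)
  singletonₙ {c} 1≤c c<k =
    toℕ-class (singleton i (subst (1 ≤_) (sym i≡c) 1≤c) (subst (_< k) (sym i≡c) c<k))
    where
    i : Fin l
    i = fromℕ< (≤-trans c<k k≤l)
    i≡c : toℕ i ≡ c
    i≡c = Fin.toℕ-fromℕ< (≤-trans c<k k≤l)
    toℕ-class : Σ (Fin n) (λ v → (col β v ≡ i) × (∀ z → col β z ≡ i → z ≡ v)) →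
                Σ (Fin n) λ v → βₙ v ≡ c × (∀ z → βₙ z ≡ c → z ≡ v)
    toℕ-class (v , βv≡i , unique) =
      v , trans (cong toℕ βv≡i) i≡c , λ z βz≡c → unique z (Fin.toℕ-injective (trans βz≡c (sym i≡c)))

  classSize-β≤1 : ∀ {c} → 1 ≤ c → c < k → classSize β c ≤ 1
  classSize-β≤1 1≤c c<k = count≤1 _ (λ {z} → proj₂ (proj₂ (singletonₙ 1≤c c<k)) z)

  classSize-β≤2 : ∀ {c} → c < k → classSize β c ≤ 2
  classSize-β≤2 {zero}  _   = count≤2 _ (λ {z} → pair z)
  classSize-β≤2 {suc c} c<k = ≤-trans (classSize-β≤1 (s≤s z≤n) c<k) (n≤1+n 1)

  #below-β≤ : #below β ≤ suc k
  #below-β≤ = ≤-trans (≤-reflexive (#below-fibres β)) (bound k ≤-refl)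
    where
    bound : ∀ j → j ≤ k → ∑[ c < j ] classSize β (toℕ c) ≤ suc j
    bound zero    _   = z≤n
    bound (suc j) j<k = +-mono-≤ (classSize-β≤2 (≤-trans (s≤s z≤n) j<k))
      (≤-trans (sum-mono-≤ (λ c → classSize-β≤1 (s≤s z≤n) (≤-trans (s≤s (Fin.toℕ<n c)) j<k)))
               (≤-reflexive (∑1≡n j)))

  mismatches≤#below : ∀ γ → AgreesBeyond γ → mismatches γ ≤ #below β
  mismatches≤#below γ agrees = count-mono (mismatch? γ) (below? β)
    (λ {z} γz≢βz → [ (λ γz≡βz → contradiction γz≡βz γz≢βz) , id ]′ (agrees⊎below γ agrees z))

  module Blocked (γ : Coloring D l) (agrees : AgreesBeyond γ)
                 (blocked : ∀ {v} → Mismatch γ v → 2 ≤ classSize γ (βₙ v)) where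

    classSize-β≤γ : ∀ {c} → c < k → classSize β c ≤ classSize γ c
    classSize-β≤γ {c} c<k with Fin.any? (λ z → (βₙ z ≟ c) ×-dec mismatch? γ z)
    ... | yes (w , refl , γw≢βw) = ≤-trans (classSize-β≤2 c<k) (blocked γw≢βw)
    ... | no  all-match          = count-mono (λ z → βₙ z ≟ c) (λ z → toℕ (col γ z) ≟ c) β⊆γ
      where
      β⊆γ : ∀ {z} → βₙ z ≡ c → toℕ (col γ z) ≡ c
      β⊆γ {z} βz≡c = trans (cong toℕ γz≡βz) βz≡c
        where
        γz≡βz = decidable-stable (col γ z Fin.≟ col β z) (λ γz≢βz → all-match (z , βz≡c , γz≢βz))

    #below-β≤γ : #below β ≤ #below γ
    #below-β≤γ = subst₂ _≤_ (sym (#below-fibres β)) (sym (#below-fibres γ))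
                        (sum-mono-≤ (λ c → classSize-β≤γ (Fin.toℕ<n c)))

    stays-below : ∀ {z} → toℕ (col γ z) < k → βₙ z < k
    stays-below {z} γz<k =
      [ (λ γz≡βz → subst (_< k) (cong toℕ γz≡βz) γz<k) , id ]′ (agrees⊎below γ agrees z)

    #below-γ≤β : #below γ ≤ #below β
    #below-γ≤β = count-mono (below? γ) (below? β) stays-below

    no-larger-class : ∀ {c} → c < k → classSize β c < classSize γ c → ⊥
    no-larger-class {c} c<k β<γ =
      <⇒≱ (subst₂ _<_ (sym (#below-fibres β)) (sym (#below-fibres γ)) sums<) #below-γ≤β
      where
      sums< : ∑[ c < k ] classSize β (toℕ c) < ∑[ c < k ] classSize γ (toℕ c)
      sums< = sum-mono-< (λ c → classSize-β≤γ (Fin.toℕ<n c)) (fromℕ< c<k)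
                (subst (λ c → classSize β c < classSize γ c) (sym (Fin.toℕ-fromℕ< c<k)) β<γ)

    no-escape : ∀ {w} → βₙ w < k → k ≤ toℕ (col γ w) → ⊥
    no-escape βw<k k≤γw =
      <⇒≱ (count-mono-< (below? γ) (below? β) stays-below (≤⇒≯ k≤γw) βw<k) #below-β≤γ

    no-crowded-singleton : ∀ {c} → 1 ≤ c → c < k → 2 ≤ classSize γ c → ⊥
    no-crowded-singleton 1≤c c<k 2≤γc =
      no-larger-class c<k (≤-trans (s≤s (classSize-β≤1 1≤c c<k)) 2≤γc)

    no-mismatch-in-pair : ∀ {w} → Mismatch γ w → βₙ w ≡ 0 → toℕ (col γ w) < k → ⊥
    no-mismatch-in-pair {w} γw≢βw βw≡0 γw<k = no-crowded-singleton 1≤c γw<k 2≤γc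
      where
      c = toℕ (col γ w)
      1≤c : 1 ≤ c
      1≤c = n≢0⇒n>0 (λ c≡0 → γw≢βw (Fin.toℕ-injective (trans c≡0 (sym βw≡0))))
      v = proj₁ (singletonₙ 1≤c γw<k)
      βv≡c : βₙ v ≡ c
      βv≡c = proj₁ (proj₂ (singletonₙ 1≤c γw<k))
      v≢w : v ≢ w
      v≢w v≡w = m<n⇒n≢0 1≤c (trans (sym βv≡c) (trans (cong βₙ v≡w) βw≡0))
      2≤γc : 2 ≤ classSize γ c
      2≤γc with col γ v Fin.≟ col β v
      ... | no  γv≢βv = subst (λ c → 2 ≤ classSize γ c) βv≡c (blocked γv≢βv)
      ... | yes γv≡βv = 2≤count _ v≢w (trans (cong toℕ γv≡βv) βv≡c) refl

    no-mismatch : ∀ {w} → Mismatch γ w → ⊥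
    no-mismatch {w} γw≢βw with agrees⊎below γ agrees w
    ... | inj₁ γw≡βw = γw≢βw γw≡βw
    ... | inj₂ βw<k with βₙ w ≟ 0
    ...   | no  βw≢0 = no-crowded-singleton (n≢0⇒n>0 βw≢0) βw<k (blocked γw≢βw)
    ...   | yes βw≡0 with toℕ (col γ w) <? k
    ...     | yes γw<k = no-mismatch-in-pair γw≢βw βw≡0 γw<k
    ...     | no  γw≮k = no-escape βw<k (≮⇒≥ γw≮k)

  fixable : ∀ γ → AgreesBeyond γ → ∀ {w} → Mismatch γ w →
            Σ (Fin n) λ v → Mismatch γ v × classSize γ (βₙ v) ≤ 1
  fixable γ agrees γw≢βw with Fin.any? (λ v → mismatch? γ v ×-dec (classSize γ (βₙ v) ≤? 1))
  ... | yes found = found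
  ... | no  none  = contradiction γw≢βw (Blocked.no-mismatch γ agrees blocked)
    where
    blocked : ∀ {v} → Mismatch γ v → 2 ≤ classSize γ (βₙ v)
    blocked {v} γv≢βv = ≰⇒> (λ small → none (v , γv≢βv , small))

  descend : ∀ γ → AgreesBeyond γ → ∀ {w} → Mismatch γ w →
            Σ (Coloring D l) λ γ′ → AgreesBeyond γ′ × Adjacent γ γ′ × mismatches γ′ < mismatches γ
  descend γ agrees γw≢βw with fixable γ agrees γw≢βw
  ... | v , γv≢βv , small =
    fix γ v small , (λ u k≤u → fix-agrees γ v small (agrees u k≤u))
                  , recolour-adjacent γ v (col β v) small γv≢βv , fix-mismatches-< γ v small γv≢βv

-- The argument uses C_1^β ⊆ {x, y}, but not x ≢ y, x, y ∈ C_1^β, 2 ≤ k or k + 1 ≤ n.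
lemma2 : ∀ {n : ℕ} (D : Digraph n) (k l : ℕ) → 2 ≤ k → k ≤ l → suc k ≤ n →
         (α β : Coloring D l) →
         -- C_1^β has exactly two vertices
         Σ (Fin n) (λ x → Σ (Fin n) λ y → (x ≢ y) × (toℕ (col β x) ≡ 0) × (toℕ (col β y) ≡ 0)
           × (∀ z → toℕ (col β z) ≡ 0 → (z ≡ x) ⊎ (z ≡ y))) →
         -- C_2^β, …, C_k^β are singletons
         (∀ (i : Fin l) → 1 ≤ toℕ i → toℕ i < k →
           Σ (Fin n) λ x → (col β x ≡ i) × (∀ z → col β z ≡ i → z ≡ x)) →
         -- α and β agree outside C_1^β ∪ … ∪ C_k^β
         (∀ u → k ≤ toℕ (col β u) → col α u ≡ col β u) →
         DistLe α β (suc k)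
lemma2 D k l _ k≤l _ α β (_ , _ , _ , _ , _ , pair) singleton agrees =
  DistLe-mono (≤-trans (mismatches≤#below α agrees) #below-β≤)
              (DistLe-by-descent AgreesBeyond descend α agrees)
  where
  open PairAndSingletons β k k≤l pair singleton
  open Descent β
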